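{- Let $\alpha\in[0,1]$ and let $T$ be a mixed tree of order $n$ and size $n-1$ (i.e. without undirected edges) with out-degrees $d^+_1,\dots,d^+_n$. Then $\mathrm{char}(A_\alpha(T))=\prod_{i\in[n]}(\lambda-\alpha d^+_i)$.
   Context: Mixed graph on $[n]$: between two distinct vertices at most one of an arc $\vec{ij}$, an undirected edge $ij$, or nothing; adjacency matrix $a_{ij}=1$ iff $\vec{ij}$ or $ij\in E$; size = arcs plus twice undirected edges. $d^+_i=|\{j:\vec{ij}\text{ or }ij\in E\}|$, $A_\alpha(T)=\alpha\,\mathrm{diag}(d^+_i)+(1-\alpha)A$. A mixed tree has a tree as underlying graph. $\mathrm{char}(M)=\det(\lambda I-M)$. -}

module Defs where

open import Level using (Level)
open import Data.Nat using (ℕ; zero; suc; _≤_)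
import Data.Nat as ℕ
open import Data.Bool using (Bool; true; false; _∨_; if_then_else_; T)
open import Data.Fin using (Fin; zero; suc; punchIn; _≟_)
open import Data.List using (List; []; _∷_; _++_; length)
open import Data.List.Relation.Unary.Linked using (Linked)
open import Data.List.Relation.Unary.Unique.Propositional using (Unique)
open import Data.Product using (Σ; _×_)
open import Relation.Nullary using (¬_; does)
open import Relation.Binary.PropositionalEquality using (_≡_)
open import Algebra.Bundles using (CommutativeRing)

-- Mixed graphs on the vertex set [n] = Fin n.
-- arc i j  : there is an arc i → j
-- edge i j : there is an undirected edge {i,j} (stored symmetrically)
-- Between two distinct vertices at most one of: arc i→j, arc j→i,
-- undirected edge, or nothing.

record MixedGraph (n : ℕ) : Set where
  field
    arc         : Fin n → Fin n → Bool
    edge        : Fin n → Fin n → Bool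
    arc-irrefl  : ∀ i → arc i i ≡ false
    edge-irrefl : ∀ i → edge i i ≡ false
    edge-sym    : ∀ i j → edge i j ≡ edge j i
    arc-antisym : ∀ i j → arc i j ≡ true → arc j i ≡ false
    arc-edge    : ∀ i j → arc i j ≡ true → edge i j ≡ false

module _ {n : ℕ} (G : MixedGraph n) where
  open MixedGraph G

  adj : Fin n → Fin n → Bool
  adj i j = arc i j ∨ edge i j

  UAdj : Fin n → Fin n → Set
  UAdj i j = T (adj i j ∨ adj j i)

sumFinℕ : ∀ {n} → (Fin n → ℕ) → ℕ
sumFinℕ {zero}  f = 0
sumFinℕ {suc n} f = f zero ℕ.+ sumFinℕ (λ i → f (suc i))

boolℕ : Bool → ℕ
boolℕ b = if b then 1 else 0

outdeg : ∀ {n} → MixedGraph n → Fin n → ℕ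
outdeg G i = sumFinℕ (λ j → boolℕ (adj G i j))

-- size = #arcs + 2 · #undirected edges = number of ordered pairs (i,j) with a_ij = 1
size : ∀ {n} → MixedGraph n → ℕ
size G = sumFinℕ (λ i → outdeg G i)

data Walk {n : ℕ} (G : MixedGraph n) : Fin n → Fin n → Set where
  []  : ∀ {i} → Walk G i i
  _∷_ : ∀ {i j k} → UAdj G i j → Walk G j k → Walk G i k

Connected : ∀ {n} → MixedGraph n → Set
Connected {n} G = ∀ (i j : Fin n) → Walk G i j

-- a cycle v ∷ vs : at least 3 distinct vertices, consecutive ones adjacent,
-- and the last adjacent to the first
IsCycle : ∀ {n} → MixedGraph n → Fin n → List (Fin n) → Set
IsCycle G v vs = (2 ≤ length vs) × Unique (v ∷ vs) × Linked (UAdj G) (v ∷ vs ++ v ∷ [])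

Acyclic : ∀ {n} → MixedGraph n → Set
Acyclic {n} G = ∀ (v : Fin n) (vs : List (Fin n)) → ¬ IsCycle G v vs

IsMixedTree : ∀ {n} → MixedGraph n → Set
IsMixedTree G = Connected G × Acyclic G

module _ {c ℓ : Level} (R : CommutativeRing c ℓ) where
  open CommutativeRing R using (Carrier; _+_; _*_; -_; _-_; 0#; 1#)

  sumFin : ∀ {n} → (Fin n → Carrier) → Carrier
  sumFin {zero}  f = 0#
  sumFin {suc n} f = f zero + sumFin (λ i → f (suc i))

  prodFin : ∀ {n} → (Fin n → Carrier) → Carrier
  prodFin {zero}  f = 1#
  prodFin {suc n} f = f zero * prodFin (λ i → f (suc i))

  fromℕ : ℕ → Carrier
  fromℕ zero    = 0#
  fromℕ (suc k) = 1# + fromℕ k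

  fromBool : Bool → Carrier
  fromBool b = if b then 1# else 0#

  signed : ℕ → Carrier → Carrier
  signed zero    x = x
  signed (suc k) x = - signed k x

  toℕF : ∀ {n} → Fin n → ℕ
  toℕF zero    = zero
  toℕF (suc i) = suc (toℕF i)

  det : ∀ {n} → (Fin n → Fin n → Carrier) → Carrier
  det {zero}  M = 1#
  det {suc n} M =
    sumFin (λ j → signed (toℕF j) (M zero j * det (λ r s → M (suc r) (punchIn j s))))

  identity : ∀ {n} → Fin n → Fin n → Carrier
  identity i j = if does (i ≟ j) then 1# else 0#

  charPolyAt : ∀ {n} → (Fin n → Fin n → Carrier) → Carrier → Carrier
  charPolyAt M x = det (λ i j → x * identity i j - M i j)

  Aα : ∀ {n} → Carrier → MixedGraph n → Fin n → Fin n → Carrier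
  Aα α G i j = α * (identity i j * fromℕ (outdeg G i)) + (1# - α) * fromBool (adj G i j)

{-# OPTIONS --safe #-}
-- Expand det (λI − A_α(T)) by the Leibniz formula.  The off-diagonal entry (i , j) vanishes
-- unless a_ij = 1, so a permutation contributes only if a_{iσ(i)} = 1 at every moved vertex i.
-- A 2-cycle of σ then needs a_ij = a_ji = 1, i.e. an undirected edge, and a longer cycle of σ
-- is a cycle of the underlying tree.  A connected graph with an undirected edge has size at
-- least n (the parent edges of a shortest-path tree contribute n − 1, the undirected edge one
-- more), so size n − 1 excludes the former and acyclicity the latter.  Only the identity
-- survives, and it contributes ∏ (λ − α d⁺_i).
module Submission where

open import Defs
open import Data.Nat using (ℕ; zero; suc)
import Data.Nat as ℕ
open import Data.Bool using (true; false; T; T?; _∨_)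
open import Data.Bool.Properties using (T-∨; T-≡; ∨-zeroʳ)
open import Data.Fin using (Fin; zero; suc; toℕ; punchIn; _≟_)
open import Data.Fin.Properties using (punchInᵢ≢i; punchIn-injective; suc-injective; any?; pigeonhole)
open import Data.List using (applyUpTo; _∷ʳ_; length)
open import Data.List.Properties using (length-applyUpTo; applyUpTo-∷ʳ)
open import Data.List.Relation.Unary.Linked using (Linked)
import Data.List.Relation.Unary.Linked.Properties as Linked
open import Data.List.Relation.Unary.Unique.Propositional using (Unique)
import Data.List.Relation.Unary.Unique.Propositional.Properties as Unique
open import Data.Product using (_×_; _,_; ∃; proj₁; proj₂)
open import Data.Sum using (_⊎_; inj₁; inj₂)
open import Data.Unit using (⊤; tt)
open import Data.Empty using (⊥; ⊥-elim)
open import Function using (_∘_; Equivalence)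
open import Function.Definitions using (Injective; Congruent)
open import Induction.WellFounded using (Acc; acc)
open import Relation.Nullary using (¬_; ¬?; Dec; yes; no; does; contradiction)
open import Relation.Nullary.Decidable using (decidable-stable; _×-dec_; _⊎-dec_; dec-true; dec-false)
open import Relation.Binary.Definitions using (Decidable)
open import Relation.Binary.PropositionalEquality
  using (_≡_; _≢_; refl; sym; trans; cong; cong₂; subst)
open import Algebra.Bundles using (CommutativeRing)

-- Lehmer codes: the code (j , q) sends 0 to j and suc r to punchIn j (q r).
Perm : ℕ → Set
Perm zero    = ⊤
Perm (suc n) = Fin (suc n) × Perm n

permute : ∀ {n} → Perm n → Fin n → Fin n
permute {suc n} (j , q) zero    = j
permute {suc n} (j , q) (suc r) = punchIn j (permute q r)

permute-injective : ∀ {n} (p : Perm n) → Injective _≡_ _≡_ (permute p)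
permute-injective {suc n} (j , q) {zero}  {zero}  _  = refl
permute-injective {suc n} (j , q) {zero}  {suc s} eq = contradiction (sym eq) (punchInᵢ≢i j (permute q s))
permute-injective {suc n} (j , q) {suc r} {zero}  eq = contradiction eq (punchInᵢ≢i j (permute q r))
permute-injective {suc n} (j , q) {suc r} {suc s} eq =
  cong suc (permute-injective q (punchIn-injective j _ _ eq))

inversions : ∀ {n} → Perm n → ℕ
inversions {zero}  _       = 0
inversions {suc n} (j , q) = toℕ j ℕ.+ inversions q

idPerm : ∀ {n} → Perm n
idPerm {zero}  = tt
idPerm {suc n} = zero , idPerm

permute-idPerm : ∀ {n} (i : Fin n) → permute idPerm i ≡ i
permute-idPerm zero    = refl
permute-idPerm (suc i) = cong suc (permute-idPerm i)

inversions-idPerm : ∀ {n} → inversions (idPerm {n}) ≡ 0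
inversions-idPerm {zero}  = refl
inversions-idPerm {suc n} = inversions-idPerm {n}

fixes-all⇒idPerm : ∀ {n} (p : Perm n) → (∀ i → permute p i ≡ i) → p ≡ idPerm
fixes-all⇒idPerm {zero}  tt      _     = refl
fixes-all⇒idPerm {suc n} (j , q) fixed with fixed zero
... | refl = cong (zero ,_) (fixes-all⇒idPerm q (suc-injective ∘ fixed ∘ suc))

toℕF≡toℕ : ∀ {c ℓ} (R : CommutativeRing c ℓ) {n} (j : Fin n) → toℕF R j ≡ toℕ j
toℕF≡toℕ R zero    = refl
toℕF≡toℕ R (suc j) = cong suc (toℕF≡toℕ R j)

-- E has no cycles: a permutation moving points only along E would have its nontrivial cycles in E.
CycleFree : ∀ {n e} → (Fin n → Fin n → Set e) → Set e
CycleFree {n} E =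
  ∀ (σ : Fin n → Fin n) → Injective _≡_ _≡_ σ →
  (∀ i → σ i ≢ i → E i (σ i)) → ∀ i → σ i ≡ i

module _ {c ℓ} (R : CommutativeRing c ℓ) where
  open CommutativeRing R hiding (zero) renaming (refl to ≈-refl; sym to ≈-sym; trans to ≈-trans)
  open import Algebra.Properties.Group +-group using (ε⁻¹≈ε)
  open import Algebra.Properties.AbelianGroup +-abelianGroup using (⁻¹-∙-comm)
  open import Algebra.Properties.Ring ring using (-‿distribʳ-*)
  open import Relation.Binary.Reasoning.Setoid setoid

  sumPerm : ∀ {n} → (Perm n → Carrier) → Carrier
  sumPerm {zero}  F = F tt
  sumPerm {suc n} F = sumFin R (λ j → sumPerm (λ q → F (j , q)))

  sumFin-cong : ∀ {n} {f g : Fin n → Carrier} → (∀ i → f i ≈ g i) → sumFin R f ≈ sumFin R g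
  sumFin-cong {zero}  f≈g = ≈-refl
  sumFin-cong {suc n} f≈g = +-cong (f≈g zero) (sumFin-cong (f≈g ∘ suc))

  sumPerm-cong : ∀ {n} {F G : Perm n → Carrier} → (∀ p → F p ≈ G p) → sumPerm F ≈ sumPerm G
  sumPerm-cong {zero}  F≈G = F≈G tt
  sumPerm-cong {suc n} F≈G = sumFin-cong (λ j → sumPerm-cong (λ q → F≈G (j , q)))

  sumFin-zero : ∀ {n} {f : Fin n → Carrier} → (∀ i → f i ≈ 0#) → sumFin R f ≈ 0#
  sumFin-zero {zero}  f≈0 = ≈-refl
  sumFin-zero {suc n} f≈0 = ≈-trans (+-cong (f≈0 zero) (sumFin-zero (f≈0 ∘ suc))) (+-identityˡ 0#)

  sumPerm-zero : ∀ {n} {F : Perm n → Carrier} → (∀ p → F p ≈ 0#) → sumPerm F ≈ 0#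
  sumPerm-zero {zero}  F≈0 = F≈0 tt
  sumPerm-zero {suc n} F≈0 = sumFin-zero (λ j → sumPerm-zero (λ q → F≈0 (j , q)))

  module _ (h : Carrier → Carrier) (h-+ : ∀ a b → h (a + b) ≈ h a + h b) (h-0 : h 0# ≈ 0#) where

    sumFin-additive : ∀ {n} (f : Fin n → Carrier) → h (sumFin R f) ≈ sumFin R (h ∘ f)
    sumFin-additive {zero}  f = h-0
    sumFin-additive {suc n} f = ≈-trans (h-+ _ _) (+-congˡ (sumFin-additive (f ∘ suc)))

    sumPerm-additive : ∀ {n} (F : Perm n → Carrier) → h (sumPerm F) ≈ sumPerm (h ∘ F)
    sumPerm-additive {zero}  F = ≈-refl
    sumPerm-additive {suc n} F =
      ≈-trans (sumFin-additive (λ j → sumPerm (λ q → F (j , q))))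
              (sumFin-cong (λ j → sumPerm-additive (λ q → F (j , q))))

  sumPerm-idPerm : ∀ {n} (F : Perm n → Carrier) → (∀ p → p ≢ idPerm → F p ≈ 0#) →
                   sumPerm F ≈ F idPerm
  sumPerm-idPerm {zero}  F vanish = ≈-refl
  sumPerm-idPerm {suc n} F vanish = ≈-trans
    (+-cong (sumPerm-idPerm (λ q → F (zero , q)) (λ q q≢id → vanish (zero , q) (q≢id ∘ cong proj₂)))
            (sumFin-zero (λ j → sumPerm-zero (λ q → vanish (suc j , q) λ ()))))
    (+-identityʳ _)

  prodFin-cong : ∀ {n} {f g : Fin n → Carrier} → (∀ i → f i ≈ g i) → prodFin R f ≈ prodFin R g
  prodFin-cong {zero}  f≈g = ≈-refl
  prodFin-cong {suc n} f≈g = *-cong (f≈g zero) (prodFin-cong (f≈g ∘ suc))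

  prodFin-zero : ∀ {n} {f : Fin n → Carrier} (i : Fin n) → f i ≈ 0# → prodFin R f ≈ 0#
  prodFin-zero {suc n} zero    fi≈0 = ≈-trans (*-congʳ fi≈0) (zeroˡ _)
  prodFin-zero {suc n} (suc i) fi≈0 = ≈-trans (*-congˡ (prodFin-zero i fi≈0)) (zeroʳ _)

  signed-cong : ∀ k → Congruent _≈_ _≈_ (signed R k)
  signed-cong zero    a≈b = a≈b
  signed-cong (suc k) a≈b = -‿cong (signed-cong k a≈b)

  signed-+ : ∀ k a b → signed R k (a + b) ≈ signed R k a + signed R k b
  signed-+ zero    a b = ≈-refl
  signed-+ (suc k) a b = ≈-trans (-‿cong (signed-+ k a b)) (≈-sym (⁻¹-∙-comm _ _))

  signed-0# : ∀ k → signed R k 0# ≈ 0#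
  signed-0# zero    = ≈-refl
  signed-0# (suc k) = ≈-trans (-‿cong (signed-0# k)) ε⁻¹≈ε

  *-signed : ∀ k a b → a * signed R k b ≈ signed R k (a * b)
  *-signed zero    a b = ≈-refl
  *-signed (suc k) a b = ≈-trans (≈-sym (-‿distribʳ-* a _)) (-‿cong (*-signed k a b))

  signed-signed : ∀ k m a → signed R k (signed R m a) ≡ signed R (k ℕ.+ m) a
  signed-signed zero    m a = refl
  signed-signed (suc k) m a = cong -_ (signed-signed k m a)

  leibnizTerm : ∀ {n} → (Fin n → Fin n → Carrier) → Perm n → Carrier
  leibnizTerm M p = signed R (inversions p) (prodFin R (λ i → M i (permute p i)))

  leibniz : ∀ {n} (M : Fin n → Fin n → Carrier) → det R M ≈ sumPerm (leibnizTerm M)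
  leibniz {zero}  M = ≈-refl
  leibniz {suc n} M = sumFin-cong expand-row
    where
    minor : Fin (suc n) → Fin n → Fin n → Carrier
    minor j r s = M (suc r) (punchIn j s)

    expand : ∀ j q → signed R (toℕF R j) (M zero j * leibnizTerm (minor j) q) ≈ leibnizTerm M (j , q)
    expand j q = begin
        signed R (toℕF R j) (M zero j * signed R (inversions q) row)
      ≈⟨ signed-cong (toℕF R j) (*-signed (inversions q) _ _) ⟩
        signed R (toℕF R j) (signed R (inversions q) (M zero j * row))
      ≡⟨ signed-signed (toℕF R j) (inversions q) _ ⟩
        signed R (toℕF R j ℕ.+ inversions q) (M zero j * row)
      ≡⟨ cong (λ k → signed R (k ℕ.+ inversions q) (M zero j * row)) (toℕF≡toℕ R j) ⟩
        leibnizTerm M (j , q)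
      ∎
      where
      row : Carrier
      row = prodFin R (λ r → minor j r (permute q r))

    expand-row : ∀ j → signed R (toℕF R j) (M zero j * det R (minor j)) ≈
                       sumPerm (λ q → leibnizTerm M (j , q))
    expand-row j = begin
        ± (M zero j * det R (minor j))
      ≈⟨ signed-cong k (*-congˡ (leibniz (minor j))) ⟩
        ± (M zero j * sumPerm (leibnizTerm (minor j)))
      ≈⟨ signed-cong k (sumPerm-additive (M zero j *_) (distribˡ (M zero j)) (zeroʳ (M zero j)) {n} _) ⟩
        ± (sumPerm (λ q → M zero j * leibnizTerm (minor j) q))
      ≈⟨ sumPerm-additive ± (signed-+ k) (signed-0# k) {n} _ ⟩
        sumPerm (λ q → ± (M zero j * leibnizTerm (minor j) q))
      ≈⟨ sumPerm-cong (expand j) ⟩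
        sumPerm (λ q → leibnizTerm M (j , q))
      ∎
      where
      k : ℕ
      k = toℕF R j
      ± : Carrier → Carrier
      ± = signed R k

  det≈prodFin-diagonal : ∀ {n e} {E : Fin n → Fin n → Set e} → Decidable E → CycleFree E →
                         (M : Fin n → Fin n → Carrier) → (∀ i j → i ≢ j → ¬ E i j → M i j ≈ 0#) →
                         det R M ≈ prodFin R (λ i → M i i)
  det≈prodFin-diagonal {n} E? cycleFree M outside-E = begin
      det R M
    ≈⟨ leibniz M ⟩
      sumPerm (leibnizTerm M)
    ≈⟨ sumPerm-idPerm (leibnizTerm M) vanish ⟩
      signed R (inversions (idPerm {n})) (prodFin R (λ i → M i (permute idPerm i)))
    ≡⟨ cong (λ k → signed R k (prodFin R (λ i → M i (permute idPerm i)))) (inversions-idPerm {n}) ⟩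
      prodFin R (λ i → M i (permute idPerm i))
    ≈⟨ prodFin-cong (λ i → reflexive (cong (M i) (permute-idPerm i))) ⟩
      prodFin R (λ i → M i i)
    ∎
    where
    vanish : ∀ p → p ≢ idPerm → leibnizTerm M p ≈ 0#
    vanish p p≢id with any? (λ i → ¬? (permute p i ≟ i) ×-dec ¬? (E? i (permute p i)))
    ... | yes (i , moved , ¬E) =
      ≈-trans (signed-cong (inversions p) (prodFin-zero i (outside-E i _ (moved ∘ sym) ¬E)))
              (signed-0# (inversions p))
    ... | no none = contradiction (fixes-all⇒idPerm p fixes-all) p≢id
      where
      fixes-all : ∀ i → permute p i ≡ i
      fixes-all = cycleFree (permute p) (permute-injective p)
        (λ i moved → decidable-stable (E? i (permute p i)) (λ ¬E → none (i , moved , ¬E)))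

  module _ {n} (G : MixedGraph n) (α x : Carrier) where
    open MixedGraph G

    charMatrix-diagonal : ∀ i → x * identity R i i - Aα R α G i i ≈ x - α * fromℕ R (outdeg G i)
    charMatrix-diagonal i rewrite dec-true (i ≟ i) refl | arc-irrefl i | edge-irrefl i =
      +-cong (*-identityʳ x) (-‿cong (begin
        α * (1# * d) + (1# - α) * 0# ≈⟨ +-cong (*-congˡ (*-identityˡ d)) (zeroʳ (1# - α)) ⟩
        α * d + 0#                   ≈⟨ +-identityʳ (α * d) ⟩
        α * d                        ∎))
      where
      d : Carrier
      d = fromℕ R (outdeg G i)

    charMatrix-off-diagonal : ∀ i j → i ≢ j → ¬ T (adj G i j) →
                              x * identity R i j - Aα R α G i j ≈ 0#
    charMatrix-off-diagonal i j i≢j ¬i~j with adj G i j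
    ... | true  = contradiction _ ¬i~j
    ... | false rewrite dec-false (i ≟ j) i≢j = begin
          x * 0# - (α * (0# * d) + (1# - α) * 0#)
        ≈⟨ +-cong (zeroʳ x) (-‿cong (+-cong (*-congˡ (zeroˡ d)) (zeroʳ (1# - α)))) ⟩
          0# - (α * 0# + 0#)
        ≈⟨ +-identityˡ _ ⟩
          - (α * 0# + 0#)
        ≈⟨ -‿cong (≈-trans (+-identityʳ (α * 0#)) (zeroʳ α)) ⟩
          - 0#
        ≈⟨ ε⁻¹≈ε ⟩
          0#
        ∎
      where
      d : Carrier
      d = fromℕ R (outdeg G i)

open import Data.Nat using (_+_; _*_; _≤_; _<_; z≤n; s≤s)
open import Data.Nat.Properties
  using (+-0-commutativeMonoid; n<1+n; +-suc; +-comm; m≤n+m; m≤n⇒∃[o]m+o≡n; anyUpTo?; ≮⇒≥; <⇒≱;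
         <-≤-trans; ≤-pred; *-identityˡ; *-identityʳ; +-identityʳ; ≤-refl; ≤-trans; ≤-reflexive;
         +-mono-≤; +-monoˡ-≤; 1+n≰n; <-irrefl; <-trans; n≤0⇒n≡0; +-cancelʳ-≤; module ≤-Reasoning)
open import Data.Nat.Induction using (<-wellFounded)
open import Algebra.Properties.CommutativeMonoid.Sum +-0-commutativeMonoid
  using (sum; ∑-distrib-+; ∑-comm; sum-cong-≗; sum-replicate-zero)

least-witness : ∀ {p} {Q : ℕ → Set p} → (∀ k → Dec (Q k)) → ∃ Q →
                ∃ λ k → Q k × (∀ {m} → Q m → k ≤ m)
least-witness {Q = Q} Q? (d , Qd) = search d (<-wellFounded d) Qd
  where
  search : ∀ d → Acc _<_ d → Q d → ∃ λ k → Q k × (∀ {m} → Q m → k ≤ m)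
  search d (acc smaller) Qd with anyUpTo? Q? d
  ... | yes (m , m<d , Qm) = search m (smaller m<d) Qm
  ... | no none            = d , Qd , λ Qm → ≮⇒≥ (λ m<d → none (_ , m<d , Qm))

Oriented : ∀ {n} → MixedGraph n → Set
Oriented G = ∀ i j → T (adj G i j) → ¬ T (adj G j i)

module Orbit {n} (G : MixedGraph n) {σ : Fin n → Fin n} (σ-injective : Injective _≡_ _≡_ σ)
             (i₀ : Fin n) where

  orbit : ℕ → Fin n
  orbit zero    = i₀
  orbit (suc k) = σ (orbit k)

  orbit-cancel : ∀ a d → orbit (a + d) ≡ orbit a → orbit d ≡ i₀
  orbit-cancel zero    d eq = eq
  orbit-cancel (suc a) d eq = orbit-cancel a d (σ-injective eq)

  orbit-recurrence : ∀ {a b} → a < b → orbit a ≡ orbit b → ∃ λ d → d < b × orbit (suc d) ≡ i₀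
  orbit-recurrence {a} a<b eq with m≤n⇒∃[o]m+o≡n a<b
  ... | d , refl = d , s≤s (m≤n+m d a) , orbit-cancel a (suc d) (trans (cong orbit (+-suc a d)) (sym eq))

  orbit-returns : ∃ λ d → orbit (suc d) ≡ i₀
  orbit-returns with pigeonhole (n<1+n n) (orbit ∘ toℕ)
  ... | i , j , i<j , eq with orbit-recurrence i<j eq
  ...   | d , _ , returns = d , returns

  module _ (acyclic : Acyclic G) (oriented : Oriented G)
           (follows : ∀ i → σ i ≢ i → T (adj G i (σ i))) (moved : σ i₀ ≢ i₀) where

    orbit-moved : ∀ k → σ (orbit k) ≢ orbit k
    orbit-moved k eq = moved (orbit-cancel k 1 (trans (cong orbit (+-comm k 1)) eq))

    orbit-step : ∀ k → UAdj G (orbit k) (orbit (suc k))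
    orbit-step k = Equivalence.from T-∨ (inj₁ (follows (orbit k) (orbit-moved k)))

    no-moved-point : ⊥
    no-moved-point with least-witness (λ d → orbit (suc d) ≟ i₀) orbit-returns
    ... | zero , returns , _ = moved returns
    ... | suc zero , returns , _ =
      oriented i₀ (σ i₀) (follows i₀ moved)
        (subst (T ∘ adj G (σ i₀)) returns (follows (σ i₀) (orbit-moved 1)))
    ... | d@(suc (suc _)) , returns , minimal =
      acyclic i₀ (applyUpTo (orbit ∘ suc) d) (long , unique , closed)
      where
      long : 2 ≤ length (applyUpTo (orbit ∘ suc) d)
      long = subst (2 ≤_) (sym (length-applyUpTo (orbit ∘ suc) d)) (s≤s (s≤s z≤n))

      unique : Unique (applyUpTo orbit (suc d))
      unique = Unique.applyUpTo⁺₁ orbit (suc d) λ b<c c<1+d eq →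
        let e , e<c , returns′ = orbit-recurrence b<c eq
        in <⇒≱ (<-≤-trans e<c (≤-pred c<1+d)) (minimal returns′)

      closed : Linked (UAdj G) (applyUpTo orbit (suc d) ∷ʳ i₀)
      closed = subst (Linked (UAdj G))
        (trans (sym (applyUpTo-∷ʳ orbit (suc d))) (cong (applyUpTo orbit (suc d) ∷ʳ_) returns))
        (Linked.applyUpTo⁺₂ orbit (suc (suc d)) orbit-step)

acyclic∧oriented⇒cycleFree : ∀ {n} {G : MixedGraph n} → Acyclic G → Oriented G →
                             CycleFree (λ i j → T (adj G i j))
acyclic∧oriented⇒cycleFree {G = G} acyclic oriented σ σ-injective follows i with σ i ≟ i
... | yes fixed = fixed
... | no  moved = ⊥-elim (Orbit.no-moved-point G σ-injective i acyclic oriented follows moved)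

δ : ∀ {n} → Fin n → Fin n → ℕ
δ k j = boolℕ (does (k ≟ j))

adjℕ : ∀ {n} → MixedGraph n → Fin n → Fin n → ℕ
adjℕ G i j = boolℕ (adj G i j)

sumFinℕ≡sum : ∀ {n} (f : Fin n → ℕ) → sumFinℕ f ≡ sum f
sumFinℕ≡sum {zero}  f = refl
sumFinℕ≡sum {suc n} f = cong (f zero +_) (sumFinℕ≡sum (f ∘ suc))

size≡∑∑adjℕ : ∀ {n} (G : MixedGraph n) → size G ≡ sum (λ i → sum (adjℕ G i))
size≡∑∑adjℕ G = trans (sumFinℕ≡sum (outdeg G)) (sum-cong-≗ (sumFinℕ≡sum ∘ adjℕ G))

∑-1 : ∀ n → sum {n} (λ _ → 1) ≡ n
∑-1 zero    = refl
∑-1 (suc n) = cong suc (∑-1 n)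

∑-δ-* : ∀ {n} (k : Fin n) (f : Fin n → ℕ) → sum (λ j → δ k j * f j) ≡ f k
∑-δ-* {suc n} zero    f =
  trans (cong₂ _+_ (*-identityˡ (f zero)) (sum-replicate-zero n)) (+-identityʳ (f zero))
∑-δ-* {suc n} (suc k) f = ∑-δ-* k (f ∘ suc)

∑-δ : ∀ {n} (k : Fin n) → sum (δ k) ≡ 1
∑-δ k = trans (sum-cong-≗ (λ j → sym (*-identityʳ (δ k j)))) (∑-δ-* k (λ _ → 1))

∑-mono-≤ : ∀ {n} {f g : Fin n → ℕ} → (∀ i → f i ≤ g i) → sum f ≤ sum g
∑-mono-≤ {zero}  f≤g = z≤n
∑-mono-≤ {suc n} f≤g = +-mono-≤ (f≤g zero) (∑-mono-≤ (f≤g ∘ suc))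

module _ {n} (G : MixedGraph n) where
  open MixedGraph G

  adj-irreflexive : ∀ i → adj G i i ≡ false
  adj-irreflexive i = cong₂ _∨_ (arc-irrefl i) (edge-irrefl i)

  UAdj⇒1≤adjℕ : ∀ {i j} → UAdj G i j → 1 ≤ adjℕ G i j + adjℕ G j i
  UAdj⇒1≤adjℕ {i} {j} i~j with adj G i j | adj G j i
  ... | true  | _    = s≤s z≤n
  ... | false | true = s≤s z≤n

  edge⇒adj : ∀ {i j} → edge i j ≡ true → adj G i j ≡ true
  edge⇒adj {i} {j} eij = trans (cong (arc i j ∨_) eij) (∨-zeroʳ (arc i j))

  -- Each ordered adjacent pair (i , j) is counted at most once: as j = p i or as i = p j.
  ∑-adjℕ-parent≤size : (p : Fin n → Fin n) → (∀ i → p (p i) ≡ i → p i ≡ i) →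
                       sum (λ i → adjℕ G i (p i) + adjℕ G (p i) i) ≤ size G
  ∑-adjℕ-parent≤size p no-2-cycle = begin
      sum (λ i → a i (p i) + a (p i) i)
    ≡⟨ ∑-distrib-+ (λ i → a i (p i)) (λ i → a (p i) i) ⟩
      sum (λ i → a i (p i)) + sum (λ i → a (p i) i)
    ≡⟨ cong₂ _+_ (sum-cong-≗ (λ i → sym (∑-δ-* (p i) (a i))))
                 (sum-cong-≗ (λ i → sym (∑-δ-* (p i) (λ j → a j i)))) ⟩
      sum (λ i → sum (outward i)) + sum (λ i → sum (λ j → δ (p i) j * a j i))
    ≡⟨ cong (sum (λ i → sum (outward i)) +_) (∑-comm (λ i j → δ (p i) j * a j i)) ⟩
      sum (λ i → sum (outward i)) + sum (λ i → sum (inward i))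
    ≡⟨ sym (∑-distrib-+ (sum ∘ outward) (sum ∘ inward)) ⟩
      sum (λ i → sum (outward i) + sum (inward i))
    ≡⟨ sum-cong-≗ (λ i → sym (∑-distrib-+ (outward i) (inward i))) ⟩
      sum (λ i → sum (λ j → outward i j + inward i j))
    ≤⟨ ∑-mono-≤ (λ i → ∑-mono-≤ (counted-once i)) ⟩
      sum (λ i → sum (a i))
    ≡⟨ sym (size≡∑∑adjℕ G) ⟩
      size G
    ∎
    where
    open ≤-Reasoning
    a : Fin n → Fin n → ℕ
    a = adjℕ G

    outward inward : Fin n → Fin n → ℕ
    outward i j = δ (p i) j * a i j
    inward  i j = δ (p j) i * a i j

    counted-once : ∀ i j → outward i j + inward i j ≤ a i j
    counted-once i j with p i ≟ j | p j ≟ i | adj G i j in adj-ij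
    ... | yes pi≡j | yes pj≡i | true  = contradiction (trans (sym adj-ii) (adj-irreflexive i)) λ ()
      where
      i≡j : i ≡ j
      i≡j = trans (sym (no-2-cycle i (trans (cong p pi≡j) pj≡i))) pi≡j
      adj-ii : adj G i i ≡ true
      adj-ii = subst (λ k → adj G i k ≡ true) (sym i≡j) adj-ij
    ... | yes _    | yes _    | false = z≤n
    ... | yes _    | no _     | true  = ≤-refl
    ... | yes _    | no _     | false = z≤n
    ... | no _     | yes _    | true  = ≤-refl
    ... | no _     | yes _    | false = z≤n
    ... | no _     | no _     | true  = z≤n
    ... | no _     | no _     | false = z≤n

module ShortestPaths {n} (G : MixedGraph n) (connected : Connected G) (root : Fin n) where

  Within : ℕ → Fin n → Set
  Within zero    v = v ≡ root
  Within (suc k) v = Within k v ⊎ ∃ λ w → UAdj G v w × Within k w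

  within? : ∀ k v → Dec (Within k v)
  within? zero    v = v ≟ root
  within? (suc k) v = within? k v ⊎-dec any? (λ w → T? _ ×-dec within? k w)

  walk⇒within : ∀ {v} → Walk G v root → ∃ λ k → Within k v
  walk⇒within []         = 0 , refl
  walk⇒within (v~w ∷ ws) = let k , within = walk⇒within ws in suc k , inj₂ (_ , v~w , within)

  depth-spec : ∀ v → ∃ λ k → Within k v × (∀ {m} → Within m v → k ≤ m)
  depth-spec v = least-witness (λ k → within? k v) (walk⇒within (connected v root))

  depth : Fin n → ℕ
  depth v = proj₁ (depth-spec v)

  depth-within : ∀ v → Within (depth v) v
  depth-within v = proj₁ (proj₂ (depth-spec v))

  depth-minimal : ∀ v {m} → Within m v → depth v ≤ m
  depth-minimal v = proj₂ (proj₂ (depth-spec v))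

  depth≡0⇒root : ∀ v → depth v ≡ 0 → v ≡ root
  depth≡0⇒root v eq = subst (λ k → Within k v) eq (depth-within v)

  closer-neighbour : ∀ v → v ≢ root → ∃ λ w → UAdj G v w × depth w < depth v
  closer-neighbour v v≢root with depth v | depth-within v | depth-minimal v
  ... | zero  | v≡root                 | _       = contradiction v≡root v≢root
  ... | suc k | inj₁ within            | minimal = contradiction (minimal within) 1+n≰n
  ... | suc k | inj₂ (w , v~w , within) | _      = w , v~w , s≤s (depth-minimal w within)

  parent : Fin n → Fin n
  parent v with v ≟ root
  ... | yes _      = root
  ... | no v≢root  = proj₁ (closer-neighbour v v≢root)

  parent-root : parent root ≡ root
  parent-root with root ≟ root
  ... | yes _        = refl
  ... | no root≢root = contradiction refl root≢root

  parent-step : ∀ v → v ≢ root → UAdj G v (parent v) × depth (parent v) < depth v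
  parent-step v v≢root with v ≟ root
  ... | yes v≡root = contradiction v≡root v≢root
  ... | no v≢root′ = proj₂ (closer-neighbour v v≢root′)

  parent-no-2-cycle : ∀ v → parent (parent v) ≡ v → parent v ≡ v
  parent-no-2-cycle v back = by-cases (v ≟ root)
    where
    by-cases : Dec (v ≡ root) → parent v ≡ v
    by-cases (yes refl)  = parent-root
    by-cases (no v≢root) = contradiction (<-trans depth-back (proj₂ (parent-step v v≢root))) (<-irrefl refl)
      where
      parent≢root : parent v ≢ root
      parent≢root eq = v≢root (trans (sym back) (trans (cong parent eq) parent-root))
      depth-back : depth v < depth (parent v)
      depth-back = subst (λ w → depth w < depth (parent v)) back (proj₂ (parent-step (parent v) parent≢root))

  parent-of-neighbour : ∀ v → UAdj G v root → parent v ≡ root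
  parent-of-neighbour v v~root = by-cases (v ≟ root)
    where
    by-cases : Dec (v ≡ root) → parent v ≡ root
    by-cases (yes refl)  = parent-root
    by-cases (no v≢root) =
      depth≡0⇒root (parent v) (n≤0⇒n≡0 (≤-pred (<-≤-trans (proj₂ (parent-step v v≢root)) depth≤1)))
      where
      depth≤1 : depth v ≤ 1
      depth≤1 = depth-minimal v (inj₂ (root , v~root , refl))

module _ {n} {G : MixedGraph n} (connected : Connected G) where
  open MixedGraph G

  connected∧edge⇒n≤size : ∀ {u v} → edge u v ≡ true → n ≤ size G
  connected∧edge⇒n≤size {u} {v} uv = +-cancelʳ-≤ 1 n (size G) (begin
      n + 1                    ≡⟨ sym (cong₂ _+_ (∑-1 n) (∑-δ v)) ⟩
      sum {n} (λ _ → 1) + sum (δ v) ≡⟨ sym (∑-distrib-+ {n} (λ _ → 1) (δ v)) ⟩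
      sum (λ i → 1 + δ v i)    ≤⟨ ∑-mono-≤ counted ⟩
      sum (λ i → t i + δ u i)  ≡⟨ ∑-distrib-+ t (δ u) ⟩
      sum t + sum (δ u)        ≡⟨ cong (sum t +_) (∑-δ u) ⟩
      sum t + 1                ≤⟨ +-monoˡ-≤ 1 (∑-adjℕ-parent≤size G parent parent-no-2-cycle) ⟩
      size G + 1               ∎)
    where
    open ≤-Reasoning
    open ShortestPaths G connected u

    t : Fin n → ℕ
    t i = adjℕ G i (parent i) + adjℕ G (parent i) i

    vu : edge v u ≡ true
    vu = trans (edge-sym v u) uv

    parent-v : parent v ≡ u
    parent-v = parent-of-neighbour v (subst (λ b → T (b ∨ adj G u v)) (sym (edge⇒adj G vu)) _)

    t-v : t v ≡ 2
    t-v = trans (cong (λ w → adjℕ G v w + adjℕ G w v) parent-v)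
                (cong₂ _+_ (cong boolℕ (edge⇒adj G vu)) (cong boolℕ (edge⇒adj G uv)))

    counted : ∀ i → 1 + δ v i ≤ t i + δ u i
    counted i with v ≟ i | u ≟ i
    ... | yes refl | yes refl = contradiction (trans (sym uv) (edge-irrefl u)) λ ()
    ... | yes refl | no _     = ≤-reflexive (sym (trans (+-identityʳ (t i)) t-v))
    ... | no _     | yes refl = m≤n+m 1 (t i)
    ... | no _     | no i≢u   =
      ≤-trans (UAdj⇒1≤adjℕ G (proj₁ (parent-step i (i≢u ∘ sym))))
              (≤-reflexive (sym (+-identityʳ (t i))))

  connected∧size≡pred⇒oriented : size G + 1 ≡ n → Oriented G
  connected∧size≡pred⇒oriented size+1≡n i j ij ji with arc i j in arc-ij
  ... | true  = subst T (cong₂ _∨_ (arc-antisym i j arc-ij) (trans (edge-sym j i) (arc-edge i j arc-ij))) ji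
  ... | false = 1+n≰n (subst (_≤ size G) (trans (sym size+1≡n) (+-comm (size G) 1))
                             (connected∧edge⇒n≤size (Equivalence.to T-≡ ij)))

corollary5p2 : ∀ {c ℓ} (R : CommutativeRing c ℓ) (n : ℕ) (T : MixedGraph n)
    → IsMixedTree T → size T + 1 ≡ n
    → (α x : CommutativeRing.Carrier R)
    → CommutativeRing._≈_ R (charPolyAt R (Aα R α T) x)
        (prodFin R (λ i → CommutativeRing._-_ R x (CommutativeRing._*_ R α (fromℕ R (outdeg T i)))))
corollary5p2 R n G (connected , acyclic) size+1≡n α x =
  CommutativeRing.trans R
    (det≈prodFin-diagonal R (λ i j → T? (adj G i j)) cycleFree _ (charMatrix-off-diagonal R G α x))
    (prodFin-cong R (charMatrix-diagonal R G α x))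
  where
  cycleFree : CycleFree (λ i j → T (adj G i j))
  cycleFree = acyclic∧oriented⇒cycleFree {G = G} acyclic (connected∧size≡pred⇒oriented connected size+1≡n)
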